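{- For every integer $n \geq 3$, the graph $C_n \star S_3$ is coprime.
   Context: A graph $G$ with $N$ vertices is \emph{coprime} (has a prime vertex labeling) if there is a bijection $f: V(G) \to \{1,2,\ldots,N\}$ such that $\gcd(f(u),f(v)) = 1$ for every edge $uv$ of $G$. For integers $n \geq 3$ and $m \geq 1$, the \emph{$m$-hairy $n$-cycle} $C_n \star S_m$ is the graph obtained from the cycle $C_n$ by attaching $m$ pendant vertices (vertices of degree one) to each cycle vertex; it has $(m+1)n$ vertices. -}

module Defs where

open import Data.Nat using (ℕ; zero; suc; _+_; _*_; _%_; _≥_; NonZero)
open import Data.Nat.Coprimality using (Coprime)
open import Data.Fin using (Fin; toℕ)
open import Data.Product using (_×_; _,_)
open import Data.Sum using (_⊎_)
open import Function.Bundles using (_⤖_; Bijection)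
open import Relation.Binary.PropositionalEquality using (_≡_)

record Graph : Set₁ where
  field
    V     : Set
    order : ℕ
    Adj   : V → V → Set

open Graph public

-- The label set {1,…,N} is represented by Fin N via k ↦ toℕ k + 1.
record IsCoprime (G : Graph) : Set where
  field
    f       : V G ⤖ Fin (order G)
    coprime : ∀ u v → Adj G u v →
              Coprime (suc (toℕ (Bijection.to f u))) (suc (toℕ (Bijection.to f v)))

-- Vertices: pairs (i , j) with i : Fin n, j : Fin (m + 1);
--   (i , 0)      is the i-th cycle vertex,
--   (i , 1 + k)  is the k-th pendant vertex attached to cycle vertex i.
data HairyEdge (n m : ℕ) : Fin n × Fin (suc m) → Fin n × Fin (suc m) → Set where
  cycleEdge   : (i j : Fin n) → (toℕ j ≡ suc (toℕ i)) ⊎ (suc (toℕ i) ≡ n × toℕ j ≡ 0) →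
                HairyEdge n m (i , Fin.zero) (j , Fin.zero)
  pendantEdge : (i : Fin n) (k : Fin m) →
                HairyEdge n m (i , Fin.zero) (i , Fin.suc k)

HairyCycle : (n m : ℕ) → Graph
HairyCycle n m = record
  { V     = Fin n × Fin (suc m)
  ; order = suc m * n
  ; Adj   = λ u v → HairyEdge n m u v ⊎ HairyEdge n m v u
  }

-- Number the blocks {cycle vertex i, its three pendants} as 4i+1, …, 4i+4.
-- Block 0 keeps its order, so cycle vertex 0 gets label 1; in every other block
-- the cycle vertex gets 4i+3 and its pendants 4i+2, 4i+1, 4i+4. A pendant edge
-- then joins 4i+3 to a consecutive integer or to the odd number 4i+1, and a cycle
-- edge joins 1 to anything or joins the odd numbers 4i+3 and 4i+7; two numbers
-- whose difference divides the successor of the smaller one are coprime.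
module Submission where

open import Defs
open import Data.Nat using (ℕ; _≥_; suc; _+_; _*_)
open import Data.Nat.Properties using (+-comm; *-comm)
open import Data.Nat.Divisibility
  using (_∣_; divides; ∣-refl; ∣-trans; ∣1⇒≡1; ∣m+n∣m⇒∣n; ∣m∣n⇒∣m+n; ∣n⇒∣m*n)
open import Data.Nat.Coprimality using (Coprime; 1-coprimeTo) renaming (sym to coprime-sym)
open import Data.Fin using (Fin; zero; suc; toℕ; cast)
open import Data.Fin.Patterns using (0F; 1F; 2F)
open import Data.Fin.Properties using (*↔×; toℕ-cast; toℕ-combine)
open import Data.Fin.Permutation
  using (Permutation′; _⟨$⟩ʳ_; _⟨$⟩ˡ_; inverseˡ; inverseʳ; id; transpose; cast-id)
open import Data.Product using (_×_; _,_)
open import Data.Sum using (inj₁; inj₂)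
open import Function.Bundles using (_↔_; Inverse; mk↔ₛ′)
open import Function.Construct.Composition using (_↔-∘_)
open import Function.Construct.Symmetry using (↔-sym)
open import Function.Properties.Inverse using (↔⇒⤖)
open import Relation.Binary.PropositionalEquality using (_≡_; refl; sym; cong; subst; subst₂; module ≡-Reasoning)

coprime-suc : ∀ m → Coprime m (suc m)
coprime-suc m {d} (d∣m , d∣1+m) = ∣1⇒≡1 (∣m+n∣m⇒∣n (subst (d ∣_) (+-comm 1 m) d∣1+m) d∣m)

d∣1+m⇒coprime-d+m : ∀ {d m} → d ∣ suc m → Coprime m (d + m)
d∣1+m⇒coprime-d+m {d} {m} d∣1+m {c} (c∣m , c∣d+m) = coprime-suc m (c∣m , ∣-trans c∣d d∣1+m)
  where
  c∣d : c ∣ d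
  c∣d = ∣m+n∣m⇒∣n (subst (c ∣_) (+-comm d m) c∣d+m) c∣m

fibrewise : ∀ {n m} → (Fin n → Permutation′ m) → (Fin n × Fin m) ↔ (Fin n × Fin m)
fibrewise π = mk↔ₛ′
  (λ (i , j) → i , π i ⟨$⟩ʳ j)
  (λ (i , j) → i , π i ⟨$⟩ˡ j)
  (λ (i , j) → cong (i ,_) (inverseʳ (π i)))
  (λ (i , j) → cong (i ,_) (inverseˡ (π i)))

blockPermutation : ∀ {n} → Fin n → Permutation′ 4
blockPermutation zero    = id
blockPermutation (suc _) = transpose 0F 2F

labelling : ∀ n → (Fin n × Fin 4) ↔ Fin (suc 3 * n)
labelling n = cast-id (*-comm n 4) ↔-∘ (↔-sym *↔× ↔-∘ fibrewise blockPermutation)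

-- Written as offset + index * 4 so that every label in a block reduces to a
-- numeral plus (toℕ i * 4), letting the coprimality lemmas apply without rewriting.
blockLabel : ∀ {n} → Fin n → Fin 4 → ℕ
blockLabel i j = suc (toℕ (blockPermutation i ⟨$⟩ʳ j) + toℕ i * 4)

label≡blockLabel : ∀ n i j → suc (toℕ (Inverse.to (labelling n) (i , j))) ≡ blockLabel i j
label≡blockLabel n i j = cong suc (begin
  toℕ (cast (*-comm n 4) combined)     ≡⟨ toℕ-cast (*-comm n 4) combined ⟩
  toℕ combined                         ≡⟨ toℕ-combine i k ⟩
  4 * toℕ i + toℕ k                    ≡⟨ +-comm (4 * toℕ i) (toℕ k) ⟩
  toℕ k + 4 * toℕ i                    ≡⟨ cong (toℕ k +_) (*-comm 4 (toℕ i)) ⟩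
  toℕ k + toℕ i * 4                    ∎)
  where
  open ≡-Reasoning
  k : Fin 4
  k = blockPermutation i ⟨$⟩ʳ j
  combined : Fin (n * 4)
  combined = Inverse.from *↔× (i , k)

2∣2+b*4 : ∀ b → 2 ∣ 2 + b * 4
2∣2+b*4 b = ∣m∣n⇒∣m+n ∣-refl (∣n⇒∣m*n b (divides 2 refl))

hairyEdge-coprime : ∀ {n i j i′ j′} → HairyEdge n 3 (i , j) (i′ , j′) →
                    Coprime (blockLabel i j) (blockLabel i′ j′)
hairyEdge-coprime (cycleEdge zero _ _)                     = 1-coprimeTo _
hairyEdge-coprime (cycleEdge (suc i) zero _)               = coprime-sym (1-coprimeTo _)
hairyEdge-coprime (cycleEdge (suc i) (suc j) (inj₁ j≡1+i)) =
  subst (λ b → Coprime (3 + a * 4) (3 + b * 4)) (sym j≡1+i)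
    (d∣1+m⇒coprime-d+m {4} (divides (suc a) refl))
  where
  a : ℕ
  a = toℕ (suc i)
hairyEdge-coprime (cycleEdge (suc i) (suc j) (inj₂ (_ , ())))
hairyEdge-coprime (pendantEdge zero _)                     = 1-coprimeTo _
hairyEdge-coprime (pendantEdge (suc i) 0F)                 = coprime-sym (coprime-suc _)
hairyEdge-coprime (pendantEdge (suc i) 1F)                 =
  coprime-sym (d∣1+m⇒coprime-d+m (2∣2+b*4 (toℕ (suc i))))
hairyEdge-coprime (pendantEdge (suc i) 2F)                 = coprime-suc _

mainTheorem1 : (n : ℕ) → n ≥ 3 → IsCoprime (HairyCycle n 3)
mainTheorem1 n _ = record
  { f       = ↔⇒⤖ (labelling n)
  ; coprime = λ (i , j) (i′ , j′) adj →
      subst₂ Coprime (sym (label≡blockLabel n i j)) (sym (label≡blockLabel n i′ j′))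
        (adjacent-coprime adj)
  }
  where
  adjacent-coprime : ∀ {i j i′ j′} → Adj (HairyCycle n 3) (i , j) (i′ , j′) →
                     Coprime (blockLabel i j) (blockLabel i′ j′)
  adjacent-coprime (inj₁ e) = hairyEdge-coprime e
  adjacent-coprime (inj₂ e) = coprime-sym (hairyEdge-coprime e)
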